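{- Let $\tau$ be the infinite Thue–Morse word and let $\psi$ be the morphism with $\psi(0)=10$, $\psi(1)=11$. Then the infinite word $\psi(\tau)$ is parameterized-cube-free.
   Context: The Thue–Morse word $\tau=0110100110010110\cdots$ is the fixed point starting with $0$ of the morphism $0\mapsto 01$, $1\mapsto 10$. A parameterized square is a word $uv$ with $|u|=|v|\ge 1$ and a bijection $f:\mathrm{Alph}(u)\to\mathrm{Alph}(v)$ ($\mathrm{Alph}$ = set of letters occurring) with $v[t]=f(u[t])$ for all $t$. A parameterized cube is a word $uvw$ with $|u|=|v|=|w|$ such that both $uv$ and $vw$ are parameterized squares. A word is parameterized-cube-free if none of its finite factors is a parameterized cube of length greater than $3$. -}

module Defs where

open import Data.Bool using (Bool; true; false; T; _∨_; if_then_else_)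
open import Data.Bool.Properties using () renaming (_≟_ to _≟B_)
open import Data.Nat using (ℕ; zero; suc; _+_; _*_)
open import Data.List using (List; []; _∷_; _++_; concatMap)
open import Data.Vec using (Vec; lookup; tabulate)
open import Data.Fin using (Fin; toℕ)
open import Data.Product using (Σ; _,_; proj₁; _×_)
open import Function using (_⤖_; Bijection)
open import Relation.Binary.PropositionalEquality using (_≡_)
open import Relation.Nullary.Decidable using (⌊_⌋)

-- Binary alphabet: false = 0, true = 1.
-- Infinite words are functions ℕ → Bool.
Word : Set
Word = ℕ → Bool

applyMorph : (Bool → List Bool) → List Bool → List Bool
applyMorph h w = concatMap h w

μ : Bool → List Bool
μ false = false ∷ true ∷ []
μ true  = true ∷ false ∷ []

ψ : Bool → List Bool
ψ false = true ∷ false ∷ []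
ψ true  = true ∷ true ∷ []

μIter : ℕ → List Bool
μIter zero    = false ∷ []
μIter (suc k) = applyMorph μ (μIter k)

-- n-th letter of a finite word (default 0 if out of range; never used out of range below)
at : List Bool → ℕ → Bool
at []      _       = false
at (x ∷ _) zero    = x
at (_ ∷ w) (suc n) = at w n

-- Thue–Morse word τ = lim μ^k(0); the n-th letter is read from μ^(n+1)(0),
-- which has length 2^(n+1) > n.
τ : Word
τ n = at (μIter (suc n)) n

-- ψ(τ): the n-th letter is read from ψ(μ^(n+1)(0)), a prefix of ψ(τ) of length 2^(n+2) > n.
ψτ : Word
ψτ n = at (applyMorph ψ (μIter (suc n))) n

factor : Word → ℕ → (ℓ : ℕ) → Vec Bool ℓ
factor w i ℓ = tabulate (λ t → w (i + toℕ t))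

elemᵇ : {n : ℕ} → Bool → Vec Bool n → Bool
elemᵇ a Vec.[]       = false
elemᵇ a (x Vec.∷ xs) = ⌊ a ≟B x ⌋ ∨ elemᵇ a xs

Alph : {n : ℕ} → Vec Bool n → Set
Alph u = Σ Bool (λ a → T (elemᵇ a u))

PSquare : {n : ℕ} → Vec Bool n → Vec Bool n → Set
PSquare {n} u v =
  Σ (Alph u ⤖ Alph v) (λ f →
    (t : Fin n) (p : T (elemᵇ (lookup u t) u)) →
      proj₁ (Bijection.to f (lookup u t , p)) ≡ lookup v t)

PCube : {n : ℕ} → Vec Bool n → Vec Bool n → Vec Bool n → Set
PCube u v w = PSquare u v × PSquare v w

-- An infinite word is parameterized-cube-free if no factor uvw with |u|=|v|=|w|=ℓ
-- and length 3ℓ > 3 (i.e. ℓ ≥ 2) is a parameterized cube.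
PCubeFree : Word → Set
PCubeFree w = (i ℓ : ℕ) → 2 Data.Nat.≤ ℓ →
  PCube (factor w i ℓ) (factor w (i + ℓ) ℓ) (factor w (i + ℓ + ℓ) ℓ) → Data.Empty.⊥
  where import Data.Empty

-- Over a binary alphabet a parameterized square uv says that v is u or its
-- complement.  So a parameterized cube uvw of period ℓ in ψ(τ) gives bits
-- d₁, d₂ with v = u ⊕ d₁ and w = v ⊕ d₂.  Even positions of ψ(τ) carry 1 and
-- odd positions spell τ; comparing an even position of u with the one 2ℓ
-- later gives d₁ = d₂ =: d.  If ℓ is even, even positions force d = 0, and
-- the odd positions yield a cube of period ℓ/2 in τ.  If ℓ is odd, every odd
-- position 2e+1 is sent to an even one, which forces τ(e) = ¬d for three
-- consecutive e.  Both are impossible: τ has no three equal consecutive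
-- letters, and τ is cube-free, because a cube of even period halves through
-- τ(2n) = τ(n) while one of odd period 2p+1 ≥ 3 makes τ(2e) = τ(2e+2) for
-- consecutive even positions.
module Submission where

open import Defs
open import Data.Bool using (Bool; true; false; not; T; _xor_)
open import Data.Bool.Properties
  using (T-∨; T-irrelevant; ¬-not; not-¬; not-injective; not-involutive)
  using (xor-comm; xor-assoc; xor-same; xor-identityʳ)
open import Data.Empty using (⊥)
open import Data.Fin using (zero; suc; fromℕ<)
open import Data.Fin.Properties using (toℕ-fromℕ<)
open import Data.List using (List; []; _∷_; _++_; length)
open import Data.List.Properties using (concatMap-++; ++-assoc; ++-identityʳ; length-++)
open import Data.Nat using (ℕ; zero; suc; _+_; _∸_; _≤_; _<_; z≤n; s≤s; _<?_; _≤′_; ≤′-refl; ≤′-step)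
open import Data.Nat.Induction using (<-rec)
open import Data.Nat.Properties
open import Data.Nat.Tactic.RingSolver using (solve-∀)
open import Data.Product using (∃-syntax; _,_; proj₁; proj₂; _×_)
open import Data.Sum using (inj₁; inj₂)
open import Data.Vec using (Vec; _∷_; lookup)
open import Data.Vec.Properties using (lookup∘tabulate)
open import Function using (Bijection; Equivalence; _∘_)
open import Relation.Nullary using (¬_; yes; no; contradiction)
open import Relation.Binary.PropositionalEquality

data Parity : ℕ → Set where
  even : ∀ b → Parity (b + b)
  odd  : ∀ b → Parity (suc (b + b))

parity : ∀ n → Parity n
parity zero = even 0
parity (suc n) with parity n
... | even b = odd b
... | odd b  = subst Parity (cong suc (+-suc b b)) (even (suc b))

double-suc : ∀ b → suc (suc (b + b)) ≡ suc b + suc b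
double-suc b = cong suc (sym (+-suc b b))

nearby-parity : ∀ a {r} → r ≤ 1 → ∃[ c ] ∃[ o ] o ≤ 1 × o + a ≡ r + (c + c)
nearby-parity a r≤1 with parity a | r≤1
... | even b | z≤n     = b , 0 , z≤n , refl
... | even b | s≤s z≤n = b , 1 , ≤-refl , refl
... | odd b  | z≤n     = suc b , 1 , ≤-refl , double-suc b
... | odd b  | s≤s z≤n = b , 0 , z≤n , refl

offset-double-< : ∀ {o k m} → o ≤ 1 → k < m → o + (k + k) < m + m
offset-double-< {o} {k} o≤1 (s≤s {n = m} k≤m) = s≤s (begin
  o + (k + k)   ≤⟨ +-monoˡ-≤ (k + k) o≤1 ⟩
  suc (k + k)   ≤⟨ s≤s (+-mono-≤ k≤m k≤m) ⟩
  suc (m + m)   ≡⟨ +-suc m m ⟨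
  m + suc m     ∎)
  where open ≤-Reasoning

offset-≤ : ∀ {o m n} → o ≤ 1 → m < n → o + m ≤ n
offset-≤ {m = m} o≤1 m<n = ≤-trans (+-monoˡ-≤ m o≤1) m<n

odd≥3 : ∀ q → 3 ≤ suc (suc q + suc q)
odd≥3 q = s≤s (s≤s (≤-trans (s≤s z≤n) (m≤n+m (suc q) q)))

at-++ˡ : ∀ (u v : List Bool) {n} → n < length u → at (u ++ v) n ≡ at u n
at-++ˡ (x ∷ u) v {zero}  _         = refl
at-++ˡ (x ∷ u) v {suc n} (s≤s n<u) = at-++ˡ u v n<u

at-++ʳ : ∀ (u v : List Bool) n → at (u ++ v) (length u + n) ≡ at v n
at-++ʳ []      v n = refl
at-++ʳ (x ∷ u) v n = at-++ʳ u v n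

module TwoUniform (h : Bool → List Bool) (|h|≡2 : ∀ x → length (h x) ≡ 2) where

  length-applyMorph : ∀ w → length (applyMorph h w) ≡ length w + length w
  length-applyMorph []      = refl
  length-applyMorph (x ∷ w) = begin
    length (h x ++ applyMorph h w)         ≡⟨ length-++ (h x) ⟩
    length (h x) + length (applyMorph h w) ≡⟨ cong₂ _+_ (|h|≡2 x) (length-applyMorph w) ⟩
    2 + (length w + length w)              ≡⟨ double-suc (length w) ⟩
    suc (length w) + suc (length w)        ∎
    where open ≡-Reasoning

  at-applyMorph : ∀ w {n r} → n < length w → r ≤ 1 →
                  at (applyMorph h w) (r + (n + n)) ≡ at (h (at w n)) r
  at-applyMorph (x ∷ w) {zero} {r} _ r≤1 = begin
    at (h x ++ applyMorph h w) (r + 0) ≡⟨ cong (at (applyMorph h (x ∷ w))) (+-identityʳ r) ⟩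
    at (h x ++ applyMorph h w) r       ≡⟨ at-++ˡ (h x) _ (subst (r <_) (sym (|h|≡2 x)) (s≤s r≤1)) ⟩
    at (h x) r                         ∎
    where open ≡-Reasoning
  at-applyMorph (x ∷ w) {suc n} {r} (s≤s n<w) r≤1 = begin
    at (h x ++ applyMorph h w) (r + (suc n + suc n))          ≡⟨ cong (at (applyMorph h (x ∷ w))) skip-h-x ⟩
    at (h x ++ applyMorph h w) (length (h x) + (r + (n + n))) ≡⟨ at-++ʳ (h x) _ _ ⟩
    at (applyMorph h w) (r + (n + n))                         ≡⟨ at-applyMorph w n<w r≤1 ⟩
    at (h (at w n)) r                                         ∎
    where
    open ≡-Reasoning
    regroup : ∀ r n → r + (suc n + suc n) ≡ 2 + (r + (n + n))
    regroup = solve-∀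
    skip-h-x : r + (suc n + suc n) ≡ length (h x) + (r + (n + n))
    skip-h-x = trans (regroup r n) (cong (_+ (r + (n + n))) (sym (|h|≡2 x)))

  applyMorph-< : ∀ w {n r} → n < length w → r ≤ 1 → r + (n + n) < length (applyMorph h w)
  applyMorph-< w n<w r≤1 =
    subst (_ <_) (sym (length-applyMorph w)) (offset-double-< r≤1 n<w)

μ-uniform : ∀ x → length (μ x) ≡ 2
μ-uniform false = refl
μ-uniform true  = refl

ψ-uniform : ∀ x → length (ψ x) ≡ 2
ψ-uniform false = refl
ψ-uniform true  = refl

open TwoUniform μ μ-uniform using ()
  renaming (length-applyMorph to length-μ; at-applyMorph to at-μ; applyMorph-< to μ-<)
open TwoUniform ψ ψ-uniform using () renaming (at-applyMorph to at-ψ)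

-- The Thue–Morse word and ψ(τ)

μIter-suc-prefix : ∀ k → ∃[ s ] μIter (suc k) ≡ μIter k ++ s
μIter-suc-prefix zero = true ∷ [] , refl
μIter-suc-prefix (suc k) with μIter-suc-prefix k
... | s , eq = applyMorph μ s , trans (cong (applyMorph μ) eq) (concatMap-++ μ (μIter k) s)

μIter-prefix : ∀ {j k} → j ≤′ k → ∃[ s ] μIter k ≡ μIter j ++ s
μIter-prefix ≤′-refl = [] , sym (++-identityʳ _)
μIter-prefix {j} (≤′-step {k} j≤k) with μIter-prefix j≤k | μIter-suc-prefix k
... | s , eq | s′ , eq′ = s ++ s′ , (begin
  μIter (suc k)          ≡⟨ eq′ ⟩
  μIter k ++ s′          ≡⟨ cong (_++ s′) eq ⟩
  (μIter j ++ s) ++ s′   ≡⟨ ++-assoc (μIter j) s s′ ⟩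
  μIter j ++ (s ++ s′)   ∎)
  where open ≡-Reasoning

<-length-μIter : ∀ {n k} → n ≤ k → n < length (μIter k)
<-length-μIter {n} {k} n≤k = ≤-<-trans n≤k (k<length k)
  where
  k<length : ∀ k → k < length (μIter k)
  k<length zero    = s≤s z≤n
  k<length (suc k) = subst (suc k <_) (sym (length-μ (μIter k)))
                       (+-mono-≤ (≤-trans (s≤s z≤n) (k<length k)) (k<length k))

at-μIter-stable : ∀ {j k n} → j ≤ k → n < length (μIter j) → at (μIter k) n ≡ at (μIter j) n
at-μIter-stable {j} {n = n} j≤k n<j with μIter-prefix (≤⇒≤′ j≤k)
... | s , eq = trans (cong (λ w → at w n) eq) (at-++ˡ (μIter j) s n<j)

τ-at : ∀ k {n} → n < length (μIter k) → at (μIter k) n ≡ τ n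
τ-at k {n} n<k with ≤-total k (suc n)
... | inj₁ k≤ = sym (at-μIter-stable k≤ n<k)
... | inj₂ k≥ = at-μIter-stable k≥ (<-length-μIter (n≤1+n n))

τ-double : ∀ r y → r ≤ 1 → τ (r + (y + y)) ≡ at (μ (τ y)) r
τ-double r y r≤1 = begin
  τ (r + (y + y))                                 ≡⟨ τ-at (suc (suc y)) (μ-< (μIter (suc y)) y<len r≤1) ⟨
  at (applyMorph μ (μIter (suc y))) (r + (y + y)) ≡⟨ at-μ (μIter (suc y)) y<len r≤1 ⟩
  at (μ (τ y)) r                                  ∎
  where
  open ≡-Reasoning
  y<len : y < length (μIter (suc y))
  y<len = <-length-μIter (n≤1+n y)

ψτ-double : ∀ r y → r ≤ 1 → ψτ (r + (y + y)) ≡ at (ψ (τ y)) r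
ψτ-double r y r≤1 = begin
  at (applyMorph ψ (μIter k)) (r + (y + y)) ≡⟨ at-ψ (μIter k) y<len r≤1 ⟩
  at (ψ (at (μIter k) y)) r                 ≡⟨ cong (λ x → at (ψ x) r) (τ-at k y<len) ⟩
  at (ψ (τ y)) r                            ∎
  where
  open ≡-Reasoning
  k = suc (r + (y + y))
  y<len : y < length (μIter k)
  y<len = <-length-μIter (≤-trans (m≤m+n y y) (≤-trans (m≤n+m (y + y) r) (n≤1+n _)))

τ-even : ∀ y → τ (y + y) ≡ τ y
τ-even y = trans (τ-double 0 y z≤n) (μ-first (τ y))
  where
  μ-first : ∀ x → at (μ x) 0 ≡ x
  μ-first false = refl
  μ-first true  = refl

τ-odd : ∀ y → τ (suc (y + y)) ≡ not (τ y)
τ-odd y = trans (τ-double 1 y ≤-refl) (μ-second (τ y))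
  where
  μ-second : ∀ x → at (μ x) 1 ≡ not x
  μ-second false = refl
  μ-second true  = refl

ψτ-even : ∀ y → ψτ (y + y) ≡ true
ψτ-even y = trans (ψτ-double 0 y z≤n) (ψ-first (τ y))
  where
  ψ-first : ∀ x → at (ψ x) 0 ≡ true
  ψ-first false = refl
  ψ-first true  = refl

ψτ-odd : ∀ y → ψτ (suc (y + y)) ≡ τ y
ψτ-odd y = trans (ψτ-double 1 y ≤-refl) (ψ-second (τ y))
  where
  ψ-second : ∀ x → at (ψ x) 1 ≡ x
  ψ-second false = refl
  ψ-second true  = refl

τ-pair-≢ : ∀ b → τ (b + b) ≢ τ (suc (b + b))
τ-pair-≢ b eq = not-¬ (τ-even b) (trans eq (τ-odd b))

τ-noTriple : ∀ a → τ a ≡ τ (suc a) → τ (suc a) ≡ τ (suc (suc a)) → ⊥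
τ-noTriple a with parity a
... | even b = λ eq _ → τ-pair-≢ b eq
... | odd b  = λ _ eq → τ-pair-≢ (suc b)
  (subst₂ (λ x y → τ x ≡ τ y) (double-suc b) (cong suc (double-suc b)) eq)

-- Factors related by a shift

record XorPeriodic (w : Word) (d : Bool) (p a n : ℕ) : Set where
  constructor xorPeriodic
  field shift : ∀ t → t < n → w (t + a + p) ≡ d xor w (t + a)

open XorPeriodic

Cube : Word → (p a : ℕ) → Set
Cube w p a = XorPeriodic w false p a (p + p)

module _ {w : Word} {d : Bool} where

  XorPeriodic-≤ : ∀ {p a m n} → m ≤ n → XorPeriodic w d p a n → XorPeriodic w d p a m
  XorPeriodic-≤ m≤n per = xorPeriodic λ t t<m → shift per t (<-≤-trans t<m m≤n)

  XorPeriodic-sub : ∀ {p a n o m x} → o + m ≤ n → o + a ≡ x →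
                    XorPeriodic w d p a n → XorPeriodic w d p x m
  XorPeriodic-sub {p} {a} {n} {o} {m} o+m≤n refl per = xorPeriodic λ t t<m →
    subst (λ z → w (z + p) ≡ d xor w z) (+-assoc t o a) (shift per (t + o) (t+o<n t<m))
    where
    t+o<n : ∀ {t} → t < m → t + o < n
    t+o<n t<m = <-≤-trans (+-monoˡ-< o t<m) (subst (_≤ n) (+-comm o m) o+m≤n)

  XorPeriodic-drop₂ : ∀ {p r c m} → XorPeriodic w d p (r + (c + c)) (2 + m) →
                      XorPeriodic w d p (r + (suc c + suc c)) m
  XorPeriodic-drop₂ {r = r} {c} = XorPeriodic-sub ≤-refl (regroup r c)
    where
    regroup : ∀ r c → 2 + (r + (c + c)) ≡ r + (suc c + suc c)
    regroup = solve-∀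

  XorPeriodic-++ : ∀ {p a n m} → XorPeriodic w d p a n → XorPeriodic w d p (a + n) m →
                   XorPeriodic w d p a (n + m)
  XorPeriodic-++ {p} {a} {n} {m} per₁ per₂ = xorPeriodic glued
    where
    glued : ∀ t → t < n + m → w (t + a + p) ≡ d xor w (t + a)
    glued t t<n+m with t <? n
    ... | yes t<n = shift per₁ t t<n
    ... | no t≮n  = subst (λ z → w (z + p) ≡ d xor w z) position (shift per₂ (t ∸ n) t∸n<m)
        where
        n≤t = ≮⇒≥ t≮n
        t∸n<m : t ∸ n < m
        t∸n<m = subst (t ∸ n <_) (m+n∸m≡n n m) (∸-monoˡ-< t<n+m n≤t)
        position : t ∸ n + (a + n) ≡ t + a
        position = begin
          t ∸ n + (a + n) ≡⟨ cong (t ∸ n +_) (+-comm a n) ⟩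
          t ∸ n + (n + a) ≡⟨ +-assoc (t ∸ n) n a ⟨
          t ∸ n + n + a   ≡⟨ cong (_+ a) (m∸n+n≡m n≤t) ⟩
          t + a           ∎
          where open ≡-Reasoning

  XorPeriodic-decimate : ∀ {v : Word} {n a c o} r → (∀ y → w (r + (y + y)) ≡ v y) →
                         o ≤ 1 → o + a ≡ r + (c + c) →
                         XorPeriodic w d (n + n) a ((n + n) + (n + n)) → XorPeriodic v d n c (n + n)
  XorPeriodic-decimate {v} {n} {a} {c} {o} r w≡v o≤1 o+a≡ per = xorPeriodic decimated
    where
    regroup₁ : ∀ o k a → o + (k + k) + a ≡ (k + k) + (o + a)
    regroup₁ = solve-∀
    regroup₂ : ∀ k r c → (k + k) + (r + (c + c)) ≡ r + ((k + c) + (k + c))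
    regroup₂ = solve-∀
    regroup₃ : ∀ r k c n → r + ((k + c + n) + (k + c + n)) ≡ r + ((k + c) + (k + c)) + (n + n)
    regroup₃ = solve-∀
    position : ∀ k → o + (k + k) + a ≡ r + ((k + c) + (k + c))
    position k = trans (regroup₁ o k a) (trans (cong ((k + k) +_) o+a≡) (regroup₂ k r c))
    decimated : ∀ k → k < n + n → v (k + c + n) ≡ d xor v (k + c)
    decimated k k<2n = begin
      v (k + c + n)                        ≡⟨ w≡v (k + c + n) ⟨
      w (r + ((k + c + n) + (k + c + n)))  ≡⟨ cong w (regroup₃ r k c n) ⟩
      w (r + ((k + c) + (k + c)) + (n + n)) ≡⟨ cong (λ z → w (z + (n + n))) (position k) ⟨
      w (o + (k + k) + a + (n + n))        ≡⟨ shift per (o + (k + k)) (offset-double-< o≤1 k<2n) ⟩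
      d xor w (o + (k + k) + a)            ≡⟨ cong (λ z → d xor w z) (position k) ⟩
      d xor w (r + ((k + c) + (k + c)))    ≡⟨ cong (d xor_) (w≡v (k + c)) ⟩
      d xor v (k + c)                      ∎
      where open ≡-Reasoning

-- Cube-freeness of τ

τ-odd-period-step : ∀ p e → XorPeriodic τ false (suc (p + p)) (e + e) 3 → τ (suc e) ≡ τ e
τ-odd-period-step p e per = begin
  τ (suc e)                       ≡⟨ τ-even (suc e) ⟨
  τ (suc e + suc e)               ≡⟨ cong τ (double-suc e) ⟨
  τ (2 + (e + e))                 ≡⟨ shift per 2 ≤-refl ⟨
  τ (2 + (e + e) + suc (p + p))   ≡⟨ cong τ (regroup₁ e p) ⟩
  τ (suc (s + s))                 ≡⟨ τ-odd s ⟩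
  not (τ s)                       ≡⟨ cong not (τ-even s) ⟨
  not (τ (s + s))                 ≡⟨ cong (not ∘ τ) (regroup₂ e p) ⟩
  not (τ (1 + (e + e) + suc (p + p))) ≡⟨ cong not (shift per 1 (s≤s (s≤s z≤n))) ⟩
  not (τ (suc (e + e)))           ≡⟨ cong not (τ-odd e) ⟩
  not (not (τ e))                 ≡⟨ not-involutive (τ e) ⟩
  τ e                             ∎
  where
  open ≡-Reasoning
  s = suc (e + p)
  regroup₁ : ∀ e p → 2 + (e + e) + suc (p + p) ≡ suc (suc (e + p) + suc (e + p))
  regroup₁ = solve-∀
  regroup₂ : ∀ e p → suc (e + p) + suc (e + p) ≡ 1 + (e + e) + suc (p + p)
  regroup₂ = solve-∀

τ-noOddCube : ∀ p a → ¬ Cube τ (suc (p + p)) a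
τ-noOddCube zero a cube = τ-noTriple a (sym (step 0 (s≤s z≤n))) (sym (step 1 ≤-refl))
  where
  step : ∀ t → t < 2 → τ (suc (t + a)) ≡ τ (t + a)
  step t t<2 = trans (cong τ (+-comm 1 (t + a))) (shift cube t t<2)
τ-noOddCube (suc q) a cube with nearby-parity a {0} z≤n
... | c , o , o≤1 , o+a≡ =
  τ-noTriple c (sym (τ-odd-period-step (suc q) c (XorPeriodic-≤ (m≤m+n 3 2) window)))
               (sym (τ-odd-period-step (suc q) (suc c) (XorPeriodic-drop₂ {r = 0} window)))
  where
  window : XorPeriodic τ false (suc (suc q + suc q)) (c + c) 5
  window = XorPeriodic-sub (offset-≤ o≤1 (+-mono-≤ (odd≥3 q) (odd≥3 q))) o+a≡ cube

τ-cubeFree : ∀ p → 1 ≤ p → ∀ a → ¬ Cube τ p a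
τ-cubeFree = <-rec (λ p → 1 ≤ p → ∀ a → ¬ Cube τ p a) noCube
  where
  noCube : ∀ p → (∀ {q} → q < p → 1 ≤ q → ∀ a → ¬ Cube τ q a) → 1 ≤ p → ∀ a → ¬ Cube τ p a
  noCube p rec 1≤p a with parity p | 1≤p
  ... | even zero    | ()
  ... | odd b        | _ = τ-noOddCube b a
  ... | even (suc b) | _ = λ cube →
    let c , o , o≤1 , o+a≡ = nearby-parity a {0} z≤n
    in rec (m<m+n (suc b) (s≤s z≤n)) (s≤s z≤n) c (XorPeriodic-decimate 0 τ-even o≤1 o+a≡ cube)

-- Parameterized squares over a binary alphabet

xor-≡ : ∀ {a b c d} → (a ≡ b → c ≡ d) → (c ≡ d → a ≡ b) → a xor c ≡ b xor d
xor-≡ {false} {false} f _ = f refl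
xor-≡ {true}  {true}  f _ = cong not (f refl)
xor-≡ {false} {true}  _ g = ¬-not (λ c≡d → contradiction (g c≡d) λ ())
xor-≡ {true}  {false} _ g = sym (¬-not (λ d≡c → contradiction (g (sym d≡c)) λ ()))

∈-Alph : ∀ {n} (u : Vec Bool n) t → T (elemᵇ (lookup u t) u)
∈-Alph (false ∷ u) zero    = _
∈-Alph (true ∷ u)  zero    = _
∈-Alph (x ∷ u)     (suc t) = Equivalence.from T-∨ (inj₂ (∈-Alph u t))

Alph-≡ : ∀ {n} (u : Vec Bool n) {a b} (pa : T (elemᵇ a u)) (pb : T (elemᵇ b u)) →
         a ≡ b → _≡_ {A = Alph u} (a , pa) (b , pb)
Alph-≡ u pa pb refl = cong (_ ,_) (T-irrelevant pa pb)

PSquare-same-pattern : ∀ {n} (u v : Vec Bool n) → PSquare u v → ∀ s t →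
  (lookup u s ≡ lookup u t → lookup v s ≡ lookup v t) ×
  (lookup v s ≡ lookup v t → lookup u s ≡ lookup u t)
PSquare-same-pattern u v (f , f-maps) s t = forward , backward
  where
  open Bijection f using (to; injective)
  forward : lookup u s ≡ lookup u t → lookup v s ≡ lookup v t
  forward eq = begin
    lookup v s                          ≡⟨ f-maps s (∈-Alph u s) ⟨
    proj₁ (to (lookup u s , ∈-Alph u s)) ≡⟨ cong (proj₁ ∘ to) (Alph-≡ u _ _ eq) ⟩
    proj₁ (to (lookup u t , ∈-Alph u t)) ≡⟨ f-maps t (∈-Alph u t) ⟩
    lookup v t                          ∎
    where open ≡-Reasoning
  backward : lookup v s ≡ lookup v t → lookup u s ≡ lookup u t
  backward eq = cong proj₁ (injective
    (Alph-≡ v (proj₂ (to (_ , ∈-Alph u s))) (proj₂ (to (_ , ∈-Alph u t)))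
      (trans (f-maps s _) (trans eq (sym (f-maps t _))))))

PSquare⇒xor : ∀ {n} (u v : Vec Bool n) → PSquare u v → ∃[ d ] ∀ t → lookup v t ≡ d xor lookup u t
PSquare⇒xor {zero}  _ _ _  = false , λ ()
PSquare⇒xor {suc n} u v sq = lookup u zero xor lookup v zero , λ t →
  let forward , backward = PSquare-same-pattern u v sq zero t
      ut = lookup u t
      vt = lookup v t
  in begin
    vt                                       ≡⟨ xor-identityʳ vt ⟨
    vt xor false                             ≡⟨ cong (vt xor_) (xor-same ut) ⟨
    vt xor (ut xor ut)                       ≡⟨ xor-assoc vt ut ut ⟨
    (vt xor ut) xor ut                       ≡⟨ cong (_xor ut) (xor-comm vt ut) ⟩
    (ut xor vt) xor ut                       ≡⟨ cong (_xor ut) (xor-≡ forward backward) ⟨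
    (lookup u zero xor lookup v zero) xor ut ∎
  where open ≡-Reasoning

lookup-factor : ∀ w a n {t} (t<n : t < n) → lookup (factor w a n) (fromℕ< t<n) ≡ w (a + t)
lookup-factor w a n t<n =
  trans (lookup∘tabulate _ (fromℕ< t<n)) (cong (λ z → w (a + z)) (toℕ-fromℕ< t<n))

PSquare⇒XorPeriodic : ∀ w a p n → PSquare (factor w a n) (factor w (a + p) n) →
                      ∃[ d ] XorPeriodic w d p a n
PSquare⇒XorPeriodic w a p n sq with PSquare⇒xor (factor w a n) (factor w (a + p) n) sq
... | d , v≡d⊕u = d , xorPeriodic λ t t<n → begin
  w (t + a + p)                            ≡⟨ cong w (regroup t a p) ⟩
  w (a + p + t)                            ≡⟨ lookup-factor w (a + p) n t<n ⟨
  lookup (factor w (a + p) n) (fromℕ< t<n) ≡⟨ v≡d⊕u (fromℕ< t<n) ⟩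
  d xor lookup (factor w a n) (fromℕ< t<n) ≡⟨ cong (d xor_) (lookup-factor w a n t<n) ⟩
  d xor w (a + t)                          ≡⟨ cong (λ z → d xor w z) (+-comm a t) ⟩
  d xor w (t + a)                          ∎
  where
  open ≡-Reasoning
  regroup : ∀ t a p → t + a + p ≡ a + p + t
  regroup = solve-∀

-- Cubes in ψ(τ)

xor-≡-true : ∀ d x → d xor x ≡ true → x ≡ not d
xor-≡-true false x    eq = eq
xor-≡-true true false _  = refl
xor-≡-true true true  ()

ψτ-even-period-sign : ∀ n {d a m} → 1 < m → XorPeriodic ψτ d (n + n) a m → d ≡ false
ψτ-even-period-sign n {d} {a} 1<m per with nearby-parity a {0} z≤n
... | e , o , o≤1 , o+a≡ = not-injective (sym (xor-≡-true d true (begin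
  d xor true             ≡⟨ cong (d xor_) (ψτ-even e) ⟨
  d xor ψτ (e + e)       ≡⟨ shift window 0 (s≤s z≤n) ⟨
  ψτ (e + e + (n + n))   ≡⟨ cong ψτ (regroup e n) ⟩
  ψτ ((e + n) + (e + n)) ≡⟨ ψτ-even (e + n) ⟩
  true                   ∎)))
  where
  open ≡-Reasoning
  window : XorPeriodic ψτ d (n + n) (e + e) 1
  window = XorPeriodic-sub (offset-≤ o≤1 1<m) o+a≡ per
  regroup : ∀ e n → e + e + (n + n) ≡ (e + n) + (e + n)
  regroup = solve-∀

ψτ-odd-shift : ∀ n e {d} → XorPeriodic ψτ d (suc (n + n)) (suc (e + e)) 1 → τ e ≡ not d
ψτ-odd-shift n e {d} per = xor-≡-true d (τ e) (begin
  d xor τ e                          ≡⟨ cong (d xor_) (ψτ-odd e) ⟨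
  d xor ψτ (suc (e + e))             ≡⟨ shift per 0 (s≤s z≤n) ⟨
  ψτ (suc (e + e) + suc (n + n))     ≡⟨ cong ψτ (regroup e n) ⟩
  ψτ (suc (e + n) + suc (e + n))     ≡⟨ ψτ-even (suc (e + n)) ⟩
  true                               ∎)
  where
  open ≡-Reasoning
  regroup : ∀ e n → suc (e + e) + suc (n + n) ≡ suc (e + n) + suc (e + n)
  regroup = solve-∀

ψτ-signs-agree : ∀ {ℓ a d₁ d₂} → 2 ≤ ℓ →
                 XorPeriodic ψτ d₁ ℓ a ℓ → XorPeriodic ψτ d₂ ℓ (a + ℓ) ℓ → d₁ ≡ d₂
ψτ-signs-agree {ℓ} {a} {d₁} {d₂} 2≤ℓ per₁ per₂ with nearby-parity a {0} z≤n
... | c , o , o≤1 , o+a≡ = signs (begin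
  d₂ xor (d₁ xor true)       ≡⟨ cong (λ z → d₂ xor (d₁ xor z)) (ψτ-even c) ⟨
  d₂ xor (d₁ xor ψτ (c + c)) ≡⟨ cong (d₂ xor_) (shift first 0 (s≤s z≤n)) ⟨
  d₂ xor ψτ (c + c + ℓ)      ≡⟨ shift second 0 (s≤s z≤n) ⟨
  ψτ (c + c + ℓ + ℓ)         ≡⟨ cong ψτ (regroup c ℓ) ⟩
  ψτ ((c + ℓ) + (c + ℓ))     ≡⟨ ψτ-even (c + ℓ) ⟩
  true                       ∎)
  where
  open ≡-Reasoning
  first : XorPeriodic ψτ d₁ ℓ (c + c) 1
  first = XorPeriodic-sub (offset-≤ o≤1 2≤ℓ) o+a≡ per₁
  second : XorPeriodic ψτ d₂ ℓ (c + c + ℓ) 1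
  second = XorPeriodic-sub (offset-≤ o≤1 2≤ℓ) (trans (sym (+-assoc o a ℓ)) (cong (_+ ℓ) o+a≡)) per₂
  regroup : ∀ c ℓ → c + c + ℓ + ℓ ≡ (c + ℓ) + (c + ℓ)
  regroup = solve-∀
  signs : ∀ {d₁ d₂} → d₂ xor (d₁ xor true) ≡ true → d₁ ≡ d₂
  signs {false} {false} _ = refl
  signs {true}  {true}  _ = refl
  signs {false} {true}  ()
  signs {true}  {false} ()

ψτ-noEvenCube : ∀ {n d a} → 1 ≤ n → ¬ XorPeriodic ψτ d (n + n) a ((n + n) + (n + n))
ψτ-noEvenCube {n} {d} {a} 1≤n per with nearby-parity a {1} ≤-refl
... | c , _ , o≤1 , o+a≡ = τ-cubeFree n 1≤n c (XorPeriodic-decimate 1 ψτ-odd o≤1 o+a≡ cube)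
  where
  d≡false : d ≡ false
  d≡false = ψτ-even-period-sign n (≤-trans (+-mono-≤ 1≤n 1≤n) (m≤m+n _ _)) per
  cube : XorPeriodic ψτ false (n + n) a ((n + n) + (n + n))
  cube = subst (λ d → XorPeriodic ψτ d (n + n) a _) d≡false per

ψτ-noOddCube : ∀ {q d a} → 3 ≤ suc (q + q) →
               ¬ XorPeriodic ψτ d (suc (q + q)) a (suc (q + q) + suc (q + q))
ψτ-noOddCube {q} {d} {a} 3≤ℓ per with nearby-parity a {1} ≤-refl
... | c , _ , o≤1 , o+a≡ = τ-noTriple c (trans τc (sym τc+1)) (trans τc+1 (sym τc+2))
  where
  window : XorPeriodic ψτ d (suc (q + q)) (1 + (c + c)) 5
  window = XorPeriodic-sub (offset-≤ o≤1 (+-mono-≤ 3≤ℓ 3≤ℓ)) o+a≡ per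
  window′ : XorPeriodic ψτ d (suc (q + q)) (1 + (suc c + suc c)) 3
  window′ = XorPeriodic-drop₂ {r = 1} {c} window
  τc = ψτ-odd-shift q c (XorPeriodic-≤ (s≤s z≤n) window)
  τc+1 = ψτ-odd-shift q (suc c) (XorPeriodic-≤ (s≤s z≤n) window′)
  τc+2 = ψτ-odd-shift q (suc (suc c)) (XorPeriodic-drop₂ {r = 1} {suc c} window′)

ψτ-noXorCube : ∀ {ℓ d a} → 2 ≤ ℓ → ¬ XorPeriodic ψτ d ℓ a (ℓ + ℓ)
ψτ-noXorCube {ℓ} 2≤ℓ with parity ℓ | 2≤ℓ
... | even zero    | ()
... | odd zero     | s≤s ()
... | even (suc n) | _ = ψτ-noEvenCube (s≤s z≤n)
... | odd (suc n)  | _ = ψτ-noOddCube {suc n} (odd≥3 n)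

theorem35 : PCubeFree ψτ
theorem35 i ℓ 2≤ℓ (sq₁ , sq₂) =
  let d₁ , per₁ = PSquare⇒XorPeriodic ψτ i ℓ ℓ sq₁
      d₂ , per₂ = PSquare⇒XorPeriodic ψτ (i + ℓ) ℓ ℓ sq₂
      d₁≡d₂ = ψτ-signs-agree 2≤ℓ per₁ per₂
      per₂′ = subst (λ d → XorPeriodic ψτ d ℓ (i + ℓ) ℓ) (sym d₁≡d₂) per₂
  in ψτ-noXorCube 2≤ℓ (XorPeriodic-++ per₁ per₂′)
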